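{- Let $r\geq 4$, let $Z_r$ be the rank-$r$ binary spike on $E=\{x_1,\dots,x_r,y_1,\dots,y_r,t\}$ with tip $t$, let $X\subseteq E$, and let $e\in X$ with $e\neq t$. Then the $es$-splitting matroid $(Z_r)^e_X$ is not isomorphic to the spike $Z_{r+1}$.
   Context: $Z_r$ ($r\ge3$) is the vector matroid over $GF(2)$ of the $r\times(2r+1)$ matrix $[I_r\,|\,J_r-I_r\,|\,\mathbf 1]$ ($J_r$ the all-ones $r\times r$ matrix, $\mathbf 1$ the all-ones column), with columns labeled in order $x_1,\dots,x_r,y_1,\dots,y_r,t$; it is a spike with tip $t$ and legs $\{t,x_i,y_i\}$. $es$-splitting: for a binary matroid $M$ on $E$ represented over $GF(2)$ by a matrix $A$, a set $X\subseteq E$ and $e\in X$, let $A^e_X$ be obtained from $A$ by adjoining a new last row that is $1$ in the columns of elements of $X$ and $0$ elsewhere, and then adjoining two new columns $\alpha$ (zero except $1$ in the new last row) and $\gamma$ (the sum of the columns of $\alpha$ and $e$). $M^e_X$ is the vector matroid of $A^e_X$, on $E\cup\{\alpha,\gamma\}$. -}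

module Defs where

open import Data.Nat using (ℕ; zero; suc; _+_)
open import Data.Fin using (Fin; zero; suc; splitAt; _↑ʳ_)
open import Data.Fin.Properties using (_≟_)
open import Data.Bool using (Bool; true; false; _∧_; _xor_; not)
open import Data.Sum using (inj₁; inj₂)
open import Relation.Nullary using (does)
open import Relation.Binary.PropositionalEquality using (_≡_)
open import Function.Bundles using (_↔_; Inverse)
open import Data.Product using (Σ; _×_)

-- GF(2) is modelled by Bool (addition = xor, multiplication = ∧).
-- A matrix over GF(2) with m rows and n columns.
Matrix : ℕ → ℕ → Set
Matrix m n = Fin m → Fin n → Bool

SubsetF : ℕ → Set
SubsetF n = Fin n → Bool

xorSum : ∀ {n} → (Fin n → Bool) → Bool
xorSum {zero}  f = false
xorSum {suc n} f = f zero xor xorSum (λ j → f (suc j))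

_⊆_ : ∀ {n} → SubsetF n → SubsetF n → Set
T ⊆ S = ∀ j → T j ≡ true → S j ≡ true

SumZero : ∀ {m n} → Matrix m n → SubsetF n → Set
SumZero A T = ∀ i → xorSum (λ j → T j ∧ A i j) ≡ false

IsEmpty : ∀ {n} → SubsetF n → Set
IsEmpty T = ∀ j → T j ≡ false

-- S is independent in the vector matroid M[A]: the columns of A indexed by S
-- are linearly independent over GF(2), i.e. no nonempty subset of them sums to 0.
Indep : ∀ {m n} → Matrix m n → SubsetF n → Set
Indep A S = ∀ T → T ⊆ S → SumZero A T → IsEmpty T

_⇔_ : Set → Set → Set
P ⇔ Q = (P → Q) × (Q → P)

-- Vector matroids M[A] (on Fin n) and M[B] (on Fin n') are isomorphic:
-- a bijection σ of ground sets such that S is independent in M[A]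
-- iff σ(S) is independent in M[B]  (σ(S) has indicator S ∘ σ⁻¹).
Isomorphic : ∀ {m m' n n'} → Matrix m n → Matrix m' n' → Set
Isomorphic {n = n} {n' = n'} A B =
  Σ (Fin n ↔ Fin n') λ σ →
    ∀ (S : SubsetF n) → Indep A S ⇔ Indep B (λ j → S (Inverse.from σ j))

-- The matrix [I_r | J_r - I_r | 1]; columns x_1..x_r, y_1..y_r, t.
Z : (r : ℕ) → Matrix r (r + r + 1)
Z r i j with splitAt (r + r) j
... | inj₂ _ = true
... | inj₁ k with splitAt r k
...   | inj₁ a = does (i ≟ a)
...   | inj₂ b = not (does (i ≟ b))

tip : (r : ℕ) → Fin (r + r + 1)
tip r = (r + r) ↑ʳ zero

-- es-splitting matrix A^e_X: new last row = indicator of X, then columns α, γ.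
split : ∀ {m n} → Matrix m n → SubsetF n → Fin n → Matrix (m + 1) (n + 2)
split {m} {n} A X e i j with splitAt m i | splitAt n j
... | inj₁ i' | inj₁ j'          = A i' j'
... | inj₂ _  | inj₁ j'          = X j'
... | inj₁ _  | inj₂ zero        = false
... | inj₂ _  | inj₂ zero        = true
... | inj₁ i' | inj₂ (suc zero)  = A i' e
... | inj₂ _  | inj₂ (suc zero)  = true xor X e

module Submission where

-- The tip t of a spike lies on a triangle (its leg) with every other element, and an
-- isomorphism of binary matroids carries such a "hub" to a hub.  The es-splitting M of
-- Z_r has no hub: every element u has a stranger p ≠ u lying on no triangle with u.
-- For u = α take p = t; for u ∉ {e, α, γ} take p = α; for u ∈ {e, γ} take p = x_m with
-- m off the leg of e.  These triples are independent because the es-splitting of a simple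
-- binary matroid is simple and, on the rows of Z_r, their columns have a nonzero sum: the
-- triangles of Z_r through x_m all lie on its leg once r ≥ 4.

open import Defs
open import Data.Nat using (ℕ; zero; suc; _+_; _≤_; _<_; s≤s; z≤n)
open import Data.Nat.Properties using (≤-trans; n≤1+n)
open import Data.Fin using (Fin; zero; suc; splitAt; _↑ˡ_; _↑ʳ_)
open import Data.Fin.Properties
  using (_≟_; ¬∀⟶∃¬; pigeonhole; <⇒≢; suc-injective; splitAt-↑ˡ; splitAt-↑ʳ; splitAt⁻¹-↑ˡ; splitAt⁻¹-↑ʳ; ↑ʳ-injective; ↑ˡ-injective)
open import Data.Bool using (Bool; true; false; _∧_; _∨_; _xor_; not)
open import Data.Bool.Properties
  using (xor-inverseʳ; xor-inverseˡ; xor-identityʳ; ∨-assoc; ∨-comm; ∨-zeroʳ; ∨-conicalˡ; ∨-conicalʳ; xor-∧-commutativeRing)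
open import Data.List using (List; []; _∷_; length; lookup)
open import Data.List.Relation.Unary.All using (All; []; _∷_)
open import Data.List.Relation.Unary.All.Properties using (¬Any⇒All¬)
open import Data.List.Membership.Propositional using (_∈_)
open import Data.List.Relation.Unary.Any using (index; any?)
open import Data.List.Relation.Unary.Any.Properties using (lookup-index)
open import Data.Sum using (inj₁; inj₂; [_,_]′)
open import Data.Product using (∃; _×_; _,_; proj₁; proj₂; map₂)
open import Relation.Nullary using (¬_; does; yes; no; contradiction)
open import Relation.Nullary.Decidable using (dec-true; dec-false; does-⇔)
open import Relation.Binary.PropositionalEquality
open import Function using (id; const; _∘_)
open import Function.Bundles using (Inverse; mk⇔)
open import Algebra.Bundles using (CommutativeRing)
open import Algebra.Properties.CommutativeSemigroup
  (CommutativeRing.+-commutativeSemigroup xor-∧-commutativeRing) using (interchange)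

private
  variable
    m n : ℕ

fresh : (xs : List (Fin n)) → length xs < n → ∃ λ i → All (i ≢_) xs
fresh {n} xs |xs|<n = map₂ (¬Any⇒All¬ xs) (¬∀⟶∃¬ n (_∈ xs) (λ i → any? (i ≟_) xs) not-all-listed)
  where
  not-all-listed : ¬ (∀ i → i ∈ xs)
  not-all-listed listed with pigeonhole |xs|<n (λ i → index (listed i))
  ... | i , j , i<j , same-index = <⇒≢ i<j (begin
    i                            ≡⟨ lookup-index (listed i) ⟩
    lookup xs (index (listed i)) ≡⟨ cong (lookup xs) same-index ⟩
    lookup xs (index (listed j)) ≡⟨ lookup-index (listed j) ⟨
    j                            ∎)
    where open ≡-Reasoning

singleton : Fin n → SubsetF n
singleton a j = does (j ≟ a)

xorSum-cong : {f g : Fin n → Bool} → f ≗ g → xorSum f ≡ xorSum g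
xorSum-cong {zero}  f≗g = refl
xorSum-cong {suc n} f≗g = cong₂ _xor_ (f≗g zero) (xorSum-cong (λ j → f≗g (suc j)))

xorSum-false : xorSum {n} (λ _ → false) ≡ false
xorSum-false {zero}  = refl
xorSum-false {suc n} = xorSum-false {n}

xorSum-xor : (f g : Fin n → Bool) → xorSum (λ j → f j xor g j) ≡ xorSum f xor xorSum g
xorSum-xor {zero}  f g = refl
xorSum-xor {suc n} f g =
  trans (cong ((f zero xor g zero) xor_) (xorSum-xor (λ j → f (suc j)) (λ j → g (suc j))))
        (interchange (f zero) (g zero) _ _)

xorSum-singleton : (a : Fin n) (v : Bool) → xorSum (λ j → singleton a j ∧ v) ≡ v
xorSum-singleton {suc n} zero    v = trans (cong (v xor_) (xorSum-false {n})) (xor-identityʳ v)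
xorSum-singleton {suc n} (suc a) v = xorSum-singleton a v

xorSum-three : (f : Fin n → Bool) {a b c : Fin n} → a ≢ b → a ≢ c → b ≢ c →
               (∀ j → j ≢ a → j ≢ b → j ≢ c → f j ≡ false) →
               xorSum f ≡ (f a xor f b) xor f c
xorSum-three f {a} {b} {c} a≢b a≢c b≢c vanishes = begin
  xorSum f
    ≡⟨ xorSum-cong decompose ⟩
  xorSum (λ j → (part a j xor part b j) xor part c j)
    ≡⟨ xorSum-xor _ (part c) ⟩
  xorSum (λ j → part a j xor part b j) xor xorSum (part c)
    ≡⟨ cong (_xor xorSum (part c)) (xorSum-xor (part a) (part b)) ⟩
  (xorSum (part a) xor xorSum (part b)) xor xorSum (part c)
    ≡⟨ cong₂ _xor_ (cong₂ _xor_ (xorSum-singleton a _) (xorSum-singleton b _)) (xorSum-singleton c _) ⟩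
  (f a xor f b) xor f c
    ∎
  where
  open ≡-Reasoning
  part : Fin _ → Fin _ → Bool
  part d j = singleton d j ∧ f d
  decompose : ∀ j → f j ≡ (part a j xor part b j) xor part c j
  decompose j with j ≟ a | j ≟ b | j ≟ c
  ... | yes refl | yes refl | _        = contradiction refl a≢b
  ... | yes refl | _        | yes refl = contradiction refl a≢c
  ... | _        | yes refl | yes refl = contradiction refl b≢c
  ... | yes refl | no _     | no _     = sym (trans (xor-identityʳ _) (xor-identityʳ _))
  ... | no _     | yes refl | no _     = sym (xor-identityʳ _)
  ... | no _     | no _     | yes refl = refl
  ... | no j≢a   | no j≢b   | no j≢c   = vanishes j j≢a j≢b j≢c

triple : Fin n → Fin n → Fin n → SubsetF n
triple a b c j = (singleton a j ∨ singleton b j) ∨ singleton c j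

triple-∋₁ : (a b c : Fin n) → triple a b c a ≡ true
triple-∋₁ a b c rewrite dec-true (a ≟ a) refl = refl

triple-∋₂ : (a b c : Fin n) → triple a b c b ≡ true
triple-∋₂ a b c rewrite dec-true (b ≟ b) refl | ∨-zeroʳ (singleton a b) = refl

triple-∋₃ : (a b c : Fin n) → triple a b c c ≡ true
triple-∋₃ a b c rewrite dec-true (c ≟ c) refl = ∨-zeroʳ _

triple-∌ : {a b c j : Fin n} → j ≢ a → j ≢ b → j ≢ c → triple a b c j ≡ false
triple-∌ {a = a} {b} {c} {j} j≢a j≢b j≢c
  rewrite dec-false (j ≟ a) j≢a | dec-false (j ≟ b) j≢b | dec-false (j ≟ c) j≢c = refl

triple-rotate : (a b c : Fin n) → triple a b c ≗ triple b c a
triple-rotate a b c j =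
  trans (∨-assoc (singleton a j) _ _) (∨-comm (singleton a j) _)

triple-swap : (a b c : Fin n) → triple a b c ≗ triple a c b
triple-swap a b c j = begin
  (x ∨ y) ∨ z  ≡⟨ ∨-assoc x y z ⟩
  x ∨ (y ∨ z)  ≡⟨ cong (x ∨_) (∨-comm y z) ⟩
  x ∨ (z ∨ y)  ≡⟨ ∨-assoc x z y ⟨
  (x ∨ z) ∨ y  ∎
  where
  open ≡-Reasoning
  x = singleton a j
  y = singleton b j
  z = singleton c j

Indep-resp : (M : Matrix m n) {S S' : SubsetF n} → S ≗ S' → Indep M S → Indep M S'
Indep-resp M S≗S' indep T T⊆S' = indep T (λ j Tj → trans (S≗S' j) (T⊆S' j Tj))

column : Matrix m n → Fin n → Fin m → Bool
column M j i = M i j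

infixl 6 _⊕_
_⊕_ : (u v : Fin m → Bool) → Fin m → Bool
(u ⊕ v) i = u i xor v i

Nonzero : (Fin m → Bool) → Set
Nonzero v = ∃ λ i → v i ≡ true

Nonzero-resp : {u v : Fin m → Bool} → u ≗ v → Nonzero u → Nonzero v
Nonzero-resp u≗v (i , uᵢ) = i , trans (sym (u≗v i)) uᵢ

record Simple (M : Matrix m n) : Set where
  field
    loopless     : ∀ j → Nonzero (column M j)
    no-parallels : ∀ {j j'} → j ≢ j' → Nonzero (column M j ⊕ column M j')

module _ {M : Matrix m n} (simple : Simple M) {a b c : Fin n}
         (a≢b : a ≢ b) (a≢c : a ≢ c) (b≢c : b ≢ c) where
  open Simple simple

  combination-nonzero : Nonzero (column M a ⊕ column M b ⊕ column M c) →
    ∀ x y z → (x ∨ y) ∨ z ≡ true →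
    Nonzero (λ i → ((x ∧ M i a) xor (y ∧ M i b)) xor (z ∧ M i c))
  combination-nonzero abc true  true  true  _ = abc
  combination-nonzero abc true  true  false _ =
    Nonzero-resp (λ i → sym (xor-identityʳ (M i a xor M i b))) (no-parallels a≢b)
  combination-nonzero abc true  false true  _ =
    Nonzero-resp (λ i → cong (_xor M i c) (sym (xor-identityʳ (M i a)))) (no-parallels a≢c)
  combination-nonzero abc true  false false _ =
    Nonzero-resp (λ i → sym (trans (xor-identityʳ _) (xor-identityʳ (M i a)))) (loopless a)
  combination-nonzero abc false true  true  _ = no-parallels b≢c
  combination-nonzero abc false true  false _ =
    Nonzero-resp (λ i → sym (xor-identityʳ (M i b))) (loopless b)
  combination-nonzero abc false false true  _ = loopless c

  triple-indep : Nonzero (column M a ⊕ column M b ⊕ column M c) → Indep M (triple a b c)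
  triple-indep abc T T⊆abc sum0 = empty
    where
    sum-over-T : ∀ i → ((T a ∧ M i a) xor (T b ∧ M i b)) xor (T c ∧ M i c) ≡ false
    sum-over-T i = trans (sym (xorSum-three (λ j → T j ∧ M i j) a≢b a≢c b≢c outside)) (sum0 i)
      where
      outside : ∀ j → j ≢ a → j ≢ b → j ≢ c → T j ∧ M i j ≡ false
      outside j j≢a j≢b j≢c with T j in Tj
      ... | false = refl
      ... | true  = contradiction (trans (sym (T⊆abc j Tj)) (triple-∌ j≢a j≢b j≢c)) λ ()
    T-misses-abc : (T a ∨ T b) ∨ T c ≡ false
    T-misses-abc with (T a ∨ T b) ∨ T c in hits
    ... | false = refl
    ... | true  with combination-nonzero abc (T a) (T b) (T c) hits
    ...   | i , sumᵢ = contradiction (trans (sym sumᵢ) (sum-over-T i)) λ ()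
    empty : IsEmpty T
    empty j with T j in Tj
    ... | false = refl
    ... | true with j ≟ a | j ≟ b | j ≟ c
    ...   | yes refl | _        | _        = trans (sym Tj) (∨-conicalˡ _ _ (∨-conicalˡ _ _ T-misses-abc))
    ...   | no _     | yes refl | _        = trans (sym Tj) (∨-conicalʳ (T a) _ (∨-conicalˡ _ (T c) T-misses-abc))
    ...   | no _     | no _     | yes refl = trans (sym Tj) (∨-conicalʳ _ _ T-misses-abc)
    ...   | no j≢a   | no j≢b   | no j≢c   = trans (sym (T⊆abc j Tj)) (triple-∌ j≢a j≢b j≢c)

triple-dep : (M : Matrix m n) {a b c : Fin n} → a ≢ b → a ≢ c → b ≢ c →
             (∀ i → (M i a xor M i b) xor M i c ≡ false) → ¬ Indep M (triple a b c)
triple-dep M {a} {b} {c} a≢b a≢c b≢c sum0 indep =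
  contradiction (trans (sym (triple-∋₁ a b c)) (indep (triple a b c) (λ _ h → h) sum-over-abc a)) λ ()
  where
  sum-over-abc : SumZero M (triple a b c)
  sum-over-abc i = begin
    xorSum (λ j → triple a b c j ∧ M i j)
      ≡⟨ xorSum-three _ a≢b a≢c b≢c (λ j j≢a j≢b j≢c → cong (_∧ M i j) (triple-∌ j≢a j≢b j≢c)) ⟩
    ((triple a b c a ∧ M i a) xor (triple a b c b ∧ M i b)) xor (triple a b c c ∧ M i c)
      ≡⟨ cong₂ _xor_ (cong₂ _xor_ (cong (_∧ M i a) (triple-∋₁ a b c)) (cong (_∧ M i b) (triple-∋₂ a b c)))
                     (cong (_∧ M i c) (triple-∋₃ a b c)) ⟩
    (M i a xor M i b) xor M i c
      ≡⟨ sum0 i ⟩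
    false ∎
    where open ≡-Reasoning

Hub : Matrix m n → Fin n → Set
Hub M u = ∀ p → p ≢ u → ∃ λ q → q ≢ p × q ≢ u × ¬ Indep M (triple p q u)

module _ {m m' n n'} {A : Matrix m n} {B : Matrix m' n'} (iso : Isomorphic A B) where
  open Inverse (proj₁ iso)

  singleton-from : ∀ a j → singleton a (from j) ≡ singleton (to a) j
  singleton-from a j = does-⇔ (mk⇔ (λ eq → trans (sym (strictlyInverseˡ j)) (cong to eq))
                                    (λ eq → trans (cong from eq) (strictlyInverseʳ a)))
                               (from j ≟ a) (j ≟ to a)

  triple-indep-image : ∀ {a b c} → Indep A (triple a b c) → Indep B (triple (to a) (to b) (to c))
  triple-indep-image {a} {b} {c} indep =
    Indep-resp B (λ j → cong₂ _∨_ (cong₂ _∨_ (singleton-from a j) (singleton-from b j)) (singleton-from c j))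
               (proj₁ (proj₂ iso (triple a b c)) indep)

  Hub-pullback : ∀ {u} → Hub B u → Hub A (from u)
  Hub-pullback {u} hub p p≢from-u = pull (hub (to p) to-p≢u)
    where
    to-p≢u : to p ≢ u
    to-p≢u to-p≡u = p≢from-u (trans (sym (strictlyInverseʳ p)) (cong from to-p≡u))
    pull : ∃ (λ q → q ≢ to p × q ≢ u × ¬ Indep B (triple (to p) q u)) →
           ∃ (λ q → q ≢ p × q ≢ from u × ¬ Indep A (triple p q (from u)))
    pull (q , q≢to-p , q≢u , dependent) =
      from q , from-q≢p , from-q≢from-u , λ indep →
        dependent (subst₂ (λ q' u' → Indep B (triple (to p) q' u'))
                          (strictlyInverseˡ q) (strictlyInverseˡ u) (triple-indep-image indep))
      where
      from-q≢p : from q ≢ p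
      from-q≢p eq = q≢to-p (trans (sym (strictlyInverseˡ q)) (cong to eq))
      from-q≢from-u : from q ≢ from u
      from-q≢from-u eq = q≢u (trans (sym (strictlyInverseˡ q)) (trans (cong to eq) (strictlyInverseˡ u)))

data SplitView (m n : ℕ) : Fin (m + n) → Set where
  inl : (i : Fin m) → SplitView m n (i ↑ˡ n)
  inr : (j : Fin n) → SplitView m n (m ↑ʳ j)

splitView : ∀ m {n} (i : Fin (m + n)) → SplitView m n i
splitView m i with splitAt m i in eq
... | inj₁ j = subst (SplitView m _) (splitAt⁻¹-↑ˡ eq) (inl j)
... | inj₂ j = subst (SplitView m _) (splitAt⁻¹-↑ʳ eq) (inr j)

↑ˡ≢↑ʳ : ∀ {m n} (i : Fin m) (j : Fin n) → i ↑ˡ n ≢ m ↑ʳ j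
↑ˡ≢↑ʳ zero    j ()
↑ˡ≢↑ʳ (suc i) j eq = ↑ˡ≢↑ʳ i j (suc-injective eq)

module Splitting {m n} (M : Matrix m n) (X : SubsetF n) (e : Fin n) where

  Mᵉ : Matrix (m + 1) (n + 2)
  Mᵉ = split M X e

  old : Fin n → Fin (n + 2)
  old j = j ↑ˡ 2

  α γ : Fin (n + 2)
  α = n ↑ʳ zero
  γ = n ↑ʳ suc zero

  top : Fin m → Fin (m + 1)
  top i = i ↑ˡ 1

  last : Fin (m + 1)
  last = m ↑ʳ zero

  -- base α = e is a junk value: every use of base comes with c ≢ α.
  base : Fin (n + 2) → Fin n
  base c = [ id , const e ]′ (splitAt n c)

  old≢α : ∀ j → old j ≢ α
  old≢α j = ↑ˡ≢↑ʳ j zero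

  base-old : ∀ j → base (old j) ≡ j
  base-old j rewrite splitAt-↑ˡ n j 2 = refl

  base-γ : base γ ≡ e
  base-γ rewrite splitAt-↑ʳ n 2 (suc (zero {0})) = refl

  top-base : ∀ {c} → c ≢ α → ∀ i → Mᵉ (top i) c ≡ M i (base c)
  top-base {c} c≢α i with splitView n c
  ... | inl j        rewrite splitAt-↑ˡ m i 1 | splitAt-↑ˡ n j 2 = refl
  ... | inr zero     = contradiction refl c≢α
  ... | inr (suc zero) rewrite splitAt-↑ˡ m i 1 | splitAt-↑ʳ n 2 (suc (zero {0})) = refl

  top-α : ∀ i → Mᵉ (top i) α ≡ false
  top-α i rewrite splitAt-↑ˡ m i 1 | splitAt-↑ʳ n 2 (zero {1}) = refl

  last-old : ∀ j → Mᵉ last (old j) ≡ X j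
  last-old j rewrite splitAt-↑ʳ m 1 (zero {0}) | splitAt-↑ˡ n j 2 = refl

  last-γ : Mᵉ last γ ≡ not (X e)
  last-γ rewrite splitAt-↑ʳ m 1 (zero {0}) | splitAt-↑ʳ n 2 (suc (zero {0})) = refl

  last-α : Mᵉ last α ≡ true
  last-α rewrite splitAt-↑ʳ m 1 (zero {0}) | splitAt-↑ʳ n 2 (zero {1}) = refl

  old-of-base : ∀ {c j} → c ≢ α → base c ≡ j → j ≢ e → c ≡ old j
  old-of-base {c} c≢α refl j≢e with splitView n c
  ... | inl j          = cong old (sym (base-old j))
  ... | inr zero       = contradiction refl c≢α
  ... | inr (suc zero) = contradiction base-γ j≢e

  last-collision : ∀ {c c'} → c ≢ α → c' ≢ α → c ≢ c' → base c ≡ base c' →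
                   Mᵉ last c xor Mᵉ last c' ≡ true
  last-collision {c} {c'} c≢α c'≢α c≢c' same-base with splitView n c | splitView n c'
  ... | inr zero | _ = contradiction refl c≢α
  ... | _ | inr zero = contradiction refl c'≢α
  ... | inl j | inl j' =
    contradiction (cong old (trans (sym (base-old j)) (trans same-base (base-old j')))) c≢c'
  ... | inr (suc zero) | inr (suc zero) = contradiction refl c≢c'
  ... | inl j | inr (suc zero) =
    trans (cong₂ _xor_ (trans (last-old j) (cong X j≡e)) last-γ) (xor-inverseʳ (X e))
    where
    j≡e : j ≡ e
    j≡e = trans (sym (base-old j)) (trans same-base base-γ)
  ... | inr (suc zero) | inl j =
    trans (cong₂ _xor_ last-γ (trans (last-old j) (cong X j≡e))) (xor-inverseˡ (X e))
    where
    j≡e : j ≡ e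
    j≡e = trans (sym (base-old j)) (trans (sym same-base) base-γ)

  Nonzero-from-top : {v : Fin (m + 1) → Bool} {w : Fin m → Bool} →
                     (∀ i → v (top i) ≡ w i) → Nonzero w → Nonzero v
  Nonzero-from-top v≗w (i , wᵢ) = top i , trans (v≗w i) wᵢ

  module _ (simple : Simple M) where
    open Simple simple

    split-simple : Simple Mᵉ
    split-simple .Simple.loopless c with c ≟ α
    ... | yes refl = last , last-α
    ... | no c≢α   = Nonzero-from-top (top-base c≢α) (loopless (base c))
    split-simple .Simple.no-parallels {c} {c'} c≢c' with c ≟ α | c' ≟ α
    ... | yes refl | yes refl = contradiction refl c≢c'
    ... | yes refl | no c'≢α  =
      Nonzero-from-top (λ i → cong₂ _xor_ (top-α i) (top-base c'≢α i)) (loopless (base c'))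
    ... | no c≢α   | yes refl =
      Nonzero-from-top (λ i → trans (cong₂ _xor_ (top-base c≢α i) (top-α i)) (xor-identityʳ _))
                       (loopless (base c))
    ... | no c≢α   | no c'≢α  with base c ≟ base c'
    ...   | yes same-base = last , last-collision c≢α c'≢α c≢c' same-base
    ...   | no  base-c≢c' =
      Nonzero-from-top (λ i → cong₂ _xor_ (top-base c≢α i) (top-base c'≢α i)) (no-parallels base-c≢c')

    triple-indep-top : ∀ {a b c} → a ≢ b → a ≢ c → b ≢ c → a ≢ α → b ≢ α → c ≢ α →
      Nonzero (column M (base a) ⊕ column M (base b) ⊕ column M (base c)) → Indep Mᵉ (triple a b c)
    triple-indep-top a≢b a≢c b≢c a≢α b≢α c≢α abc =
      triple-indep split-simple a≢b a≢c b≢c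
        (Nonzero-from-top (λ i → cong₂ _xor_ (cong₂ _xor_ (top-base a≢α i) (top-base b≢α i)) (top-base c≢α i)) abc)

    triple-indep-α : ∀ {a b} → a ≢ α → b ≢ α → base a ≢ base b → Indep Mᵉ (triple a b α)
    triple-indep-α {a} {b} a≢α b≢α base-a≢b =
      triple-indep split-simple (λ a≡b → base-a≢b (cong base a≡b)) a≢α b≢α
        (Nonzero-from-top (λ i → trans (cong₂ _xor_ (cong₂ _xor_ (top-base a≢α i) (top-base b≢α i)) (top-α i))
                                        (xor-identityʳ _))
                          (no-parallels base-a≢b))

module Spike (r : ℕ) where

  x y : Fin r → Fin (r + r + 1)
  x a = (a ↑ˡ r) ↑ˡ 1
  y b = (r ↑ʳ b) ↑ˡ 1

  data Element : Fin (r + r + 1) → Set where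
    leg-x : ∀ a → Element (x a)
    leg-y : ∀ b → Element (y b)
    leg-t : Element (tip r)

  element : ∀ j → Element j
  element j with splitView (r + r) j
  ... | inr zero = leg-t
  ... | inl k with splitView r k
  ...   | inl a = leg-x a
  ...   | inr b = leg-y b

  x≢y : ∀ a b → x a ≢ y b
  x≢y a b eq = ↑ˡ≢↑ʳ a b (↑ˡ-injective 1 _ _ eq)

  x-injective : ∀ {a b} → x a ≡ x b → a ≡ b
  x-injective eq = ↑ˡ-injective r _ _ (↑ˡ-injective 1 _ _ eq)

  y-injective : ∀ {a b} → y a ≡ y b → a ≡ b
  y-injective eq = ↑ʳ-injective r _ _ (↑ˡ-injective 1 _ _ eq)

  x≢t : ∀ a → x a ≢ tip r
  x≢t a = ↑ˡ≢↑ʳ (a ↑ˡ r) zero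

  y≢t : ∀ b → y b ≢ tip r
  y≢t b = ↑ˡ≢↑ʳ (r ↑ʳ b) zero

  x-entry : ∀ i a → Z r i (x a) ≡ singleton a i
  x-entry i a rewrite splitAt-↑ˡ (r + r) (a ↑ˡ r) 1 | splitAt-↑ˡ r a r = refl

  y-entry : ∀ i b → Z r i (y b) ≡ not (singleton b i)
  y-entry i b rewrite splitAt-↑ˡ (r + r) (r ↑ʳ b) 1 | splitAt-↑ʳ r r b = refl

  t-entry : ∀ i → Z r i (tip r) ≡ true
  t-entry i rewrite splitAt-↑ʳ (r + r) 1 zero = refl

  x-on : ∀ a → Z r a (x a) ≡ true
  x-on a = trans (x-entry a a) (dec-true (a ≟ a) refl)

  x-off : ∀ {i a} → i ≢ a → Z r i (x a) ≡ false
  x-off {i} {a} i≢a = trans (x-entry i a) (dec-false (i ≟ a) i≢a)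

  y-on : ∀ b → Z r b (y b) ≡ false
  y-on b = trans (y-entry b b) (cong not (dec-true (b ≟ b) refl))

  y-off : ∀ {i b} → i ≢ b → Z r i (y b) ≡ true
  y-off {i} {b} i≢b = trans (y-entry i b) (cong not (dec-false (i ≟ b) i≢b))

  Z-simple : 2 < r → Simple (Z r)
  Z-simple r>2 .Simple.loopless j with element j
  ... | leg-x a = a , x-on a
  ... | leg-y b with fresh (b ∷ b ∷ []) r>2
  ...   | i , i≢b ∷ _ = i , y-off i≢b
  Z-simple r>2 .Simple.loopless j | leg-t with fresh [] (≤-trans (s≤s z≤n) r>2)
  ...   | i , [] = i , t-entry i
  Z-simple r>2 .Simple.no-parallels {j} {j'} j≢j' with element j | element j'
  ... | leg-x a | leg-x b = a , cong₂ _xor_ (x-on a) (x-off (λ a≡b → j≢j' (cong x a≡b)))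
  ... | leg-x a | leg-y b with fresh (a ∷ b ∷ []) r>2
  ...   | i , i≢a ∷ i≢b ∷ [] = i , cong₂ _xor_ (x-off i≢a) (y-off i≢b)
  Z-simple r>2 .Simple.no-parallels j≢j' | leg-x a | leg-t with fresh (a ∷ a ∷ []) r>2
  ...   | i , i≢a ∷ _ = i , cong₂ _xor_ (x-off i≢a) (t-entry i)
  Z-simple r>2 .Simple.no-parallels j≢j' | leg-y a | leg-x b with fresh (a ∷ b ∷ []) r>2
  ...   | i , i≢a ∷ i≢b ∷ [] = i , cong₂ _xor_ (y-off i≢a) (x-off i≢b)
  Z-simple r>2 .Simple.no-parallels j≢j' | leg-y a | leg-y b =
    a , cong₂ _xor_ (y-on a) (y-off (λ a≡b → j≢j' (cong y a≡b)))
  Z-simple r>2 .Simple.no-parallels j≢j' | leg-y a | leg-t = a , cong₂ _xor_ (y-on a) (t-entry a)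
  Z-simple r>2 .Simple.no-parallels j≢j' | leg-t | leg-x b with fresh (b ∷ b ∷ []) r>2
  ...   | i , i≢b ∷ _ = i , cong₂ _xor_ (t-entry i) (x-off i≢b)
  Z-simple r>2 .Simple.no-parallels j≢j' | leg-t | leg-y b = b , cong₂ _xor_ (t-entry b) (y-on b)
  Z-simple r>2 .Simple.no-parallels j≢j' | leg-t | leg-t = contradiction refl j≢j'

  tip-hub : Hub (Z r) (tip r)
  tip-hub p p≢t with element p
  ... | leg-x a = y a , (λ eq → x≢y a a (sym eq)) , y≢t a ,
    triple-dep (Z r) (x≢y a a) (x≢t a) (y≢t a) λ i →
      trans (cong₂ _xor_ (cong₂ _xor_ (x-entry i a) (y-entry i a)) (t-entry i))
            (cong (_xor true) (xor-inverseʳ (singleton a i)))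
  ... | leg-y a = x a , x≢y a a , x≢t a ,
    triple-dep (Z r) (λ eq → x≢y a a (sym eq)) (y≢t a) (x≢t a) λ i →
      trans (cong₂ _xor_ (cong₂ _xor_ (y-entry i a) (x-entry i a)) (t-entry i))
            (cong (_xor true) (xor-inverseˡ (singleton a i)))
  ... | leg-t = contradiction refl p≢t

  x-triangle : 3 < r → ∀ m {j j'} → j' ≢ x m → j' ≢ y m → j' ≢ tip r →
               Nonzero (column (Z r) (x m) ⊕ column (Z r) j ⊕ column (Z r) j')
  x-triangle r>3 m {j} {j'} j'≢xm j'≢ym j'≢t with element j'
  ... | leg-t = contradiction refl j'≢t
  ... | leg-x k = on-x-leg (element j)
    where
    k≢m : k ≢ m
    k≢m k≡m = j'≢xm (cong x k≡m)
    on-x-leg : ∀ {j} → Element j → Nonzero (column (Z r) (x m) ⊕ column (Z r) j ⊕ column (Z r) (x k))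
    on-x-leg (leg-x l) with l ≟ m
    ... | yes refl = k , cong₂ _xor_ (cong₂ _xor_ (x-off k≢m) (x-off k≢m)) (x-on k)
    ... | no l≢m   = m , cong₂ _xor_ (cong₂ _xor_ (x-on m) (x-off (l≢m ∘ sym))) (x-off (k≢m ∘ sym))
    on-x-leg (leg-y l) with fresh (m ∷ l ∷ k ∷ []) r>3
    ... | i , i≢m ∷ i≢l ∷ i≢k ∷ [] = i , cong₂ _xor_ (cong₂ _xor_ (x-off i≢m) (y-off i≢l)) (x-off i≢k)
    on-x-leg leg-t with fresh (m ∷ k ∷ k ∷ []) r>3
    ... | i , i≢m ∷ i≢k ∷ _ = i , cong₂ _xor_ (cong₂ _xor_ (x-off i≢m) (t-entry i)) (x-off i≢k)
  ... | leg-y k = on-y-leg (element j)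
    where
    k≢m : k ≢ m
    k≢m k≡m = j'≢ym (cong y k≡m)
    on-y-leg : ∀ {j} → Element j → Nonzero (column (Z r) (x m) ⊕ column (Z r) j ⊕ column (Z r) (y k))
    on-y-leg (leg-x l) with fresh (m ∷ l ∷ k ∷ []) r>3
    ... | i , i≢m ∷ i≢l ∷ i≢k ∷ [] = i , cong₂ _xor_ (cong₂ _xor_ (x-off i≢m) (x-off i≢l)) (y-off i≢k)
    on-y-leg (leg-y l) with l ≟ m
    ... | yes refl = k , cong₂ _xor_ (cong₂ _xor_ (x-off k≢m) (y-off k≢m)) (y-on k)
    ... | no l≢m   = m , cong₂ _xor_ (cong₂ _xor_ (x-on m) (y-off (l≢m ∘ sym))) (y-off (k≢m ∘ sym))
    on-y-leg leg-t = m , cong₂ _xor_ (cong₂ _xor_ (x-on m) (t-entry m)) (y-off (k≢m ∘ sym))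

  off-leg : 1 < r → ∀ {e} → e ≢ tip r → ∃ λ m → e ≢ x m × e ≢ y m
  off-leg r>1 {e} e≢t with element e
  ... | leg-x a with fresh (a ∷ []) r>1
  ...   | m , m≢a ∷ [] = m , (λ xa≡xm → m≢a (sym (x-injective xa≡xm))) , (λ xa≡ym → x≢y a m xa≡ym)
  off-leg r>1 e≢t | leg-y b with fresh (b ∷ []) r>1
  ...   | m , m≢b ∷ [] = m , (λ yb≡xm → x≢y m b (sym yb≡xm)) , (λ yb≡ym → m≢b (sym (y-injective yb≡ym)))
  off-leg r>1 e≢t | leg-t = contradiction refl e≢t

module _ {r} (r>3 : 3 < r) (X : SubsetF (r + r + 1)) {e} (e≢t : e ≢ tip r) where
  open Spike r
  open Splitting (Z r) X e

  private
    Zᵣ-simple : Simple (Z r)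
    Zᵣ-simple = Z-simple (≤-trans (n≤1+n 3) r>3)

  stranger : ∀ u → ∃ λ p → p ≢ u × (∀ q → q ≢ p → q ≢ u → Indep Mᵉ (triple p q u))
  stranger u with u ≟ α
  ... | yes refl = old (tip r) , old≢α (tip r) , λ q q≢p q≢α →
    triple-indep-α Zᵣ-simple (old≢α (tip r)) q≢α λ same-base →
      q≢p (old-of-base q≢α (trans (sym same-base) (base-old (tip r))) (e≢t ∘ sym))
  ... | no u≢α with base u ≟ e
  ...   | no base-u≢e = α , u≢α ∘ sym , λ q q≢α q≢u →
    Indep-resp Mᵉ (sym ∘ triple-rotate α q u)
      (triple-indep-α Zᵣ-simple q≢α u≢α λ same-base →
        q≢u (trans (old-of-base q≢α same-base base-u≢e) (sym (old-of-base u≢α refl base-u≢e))))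
  ...   | yes base-u≡e with off-leg (≤-trans (s≤s (s≤s z≤n)) r>3) e≢t
  ...     | m , e≢xm , e≢ym = old (x m) , p≢u , independent
    where
    base-p≢u : base (old (x m)) ≢ base u
    base-p≢u same-base = e≢xm (trans (sym base-u≡e) (trans (sym same-base) (base-old (x m))))
    p≢u : old (x m) ≢ u
    p≢u p≡u = base-p≢u (cong base p≡u)
    independent : ∀ q → q ≢ old (x m) → q ≢ u → Indep Mᵉ (triple (old (x m)) q u)
    independent q q≢p q≢u with q ≟ α
    ... | yes refl = Indep-resp Mᵉ (triple-swap (old (x m)) u α)
                       (triple-indep-α Zᵣ-simple (old≢α (x m)) u≢α base-p≢u)
    ... | no q≢α = triple-indep-top Zᵣ-simple (q≢p ∘ sym) p≢u q≢u (old≢α (x m)) q≢α u≢α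
      (subst₂ (λ a c → Nonzero (column (Z r) a ⊕ column (Z r) (base q) ⊕ column (Z r) c))
              (sym (base-old (x m))) (sym base-u≡e)
              (x-triangle r>3 m e≢xm e≢ym e≢t))

  split-spike-no-hub : ∀ u → ¬ Hub Mᵉ u
  split-spike-no-hub u hub with stranger u
  ... | p , p≢u , independent with hub p p≢u
  ...   | q , q≢p , q≢u , dependent = dependent (independent q q≢p q≢u)

lemma7 : (r : ℕ) → 4 ≤ r → (X : SubsetF (r + r + 1)) → (e : Fin (r + r + 1)) →
           X e ≡ true → e ≢ tip r →
           ¬ Isomorphic (split (Z r) X e) (Z (suc r))
lemma7 r r≥4 X e _ e≢t iso =
  split-spike-no-hub r≥4 X e≢t _ (Hub-pullback {B = Z (suc r)} iso (Spike.tip-hub (suc r)))
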